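{- In any NL-coloring of a cycle $C_n$, every vertex of color-degree $1$ has at least one neighbor of color-degree $2$.
   Context: A $k$-coloring of a graph $G$ is a partition of $V(G)$ into $k$ independent sets (colors). A coloring $\{S_1,\dots,S_k\}$ is neighbor-locating (an NL-coloring) if for any two distinct vertices $u,v$ in the same color class, $\{j: N(u)\cap S_j\neq\emptyset\}\neq\{j: N(v)\cap S_j\neq\emptyset\}$. The color-degree of a vertex $v$ is $|\{j: N(v)\cap S_j\neq\emptyset\}|$. -}

module Defs where

open import Data.Nat using (ℕ; zero; suc; _≤_)
import Data.Nat as ℕ
open import Data.Fin using (Fin; toℕ; _≟_)
open import Data.Fin.Subset using (Subset; ∣_∣)
open import Data.Vec using (tabulate)
open import Data.Fin.Properties using (any?)
open import Data.Product using (_×_; Σ; ∃)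
open import Data.Sum using (_⊎_)
open import Relation.Nullary using (Dec; ¬_; does)
open import Relation.Nullary.Decidable using (_×-dec_; _⊎-dec_)
open import Relation.Binary.PropositionalEquality using (_≡_; _≢_)

record Graph (n : ℕ) : Set₁ where
  field
    Adj  : Fin n → Fin n → Set
    adj? : ∀ u v → Dec (Adj u v)
open Graph public

CycleAdj : (n : ℕ) → Fin n → Fin n → Set
CycleAdj n i j =
    (toℕ j ≡ suc (toℕ i))
  ⊎ (toℕ i ≡ suc (toℕ j))
  ⊎ ((toℕ i ≡ 0) × (suc (toℕ j) ≡ n))
  ⊎ ((toℕ j ≡ 0) × (suc (toℕ i) ≡ n))

cycleAdj? : (n : ℕ) → ∀ i j → Dec (CycleAdj n i j)
cycleAdj? n i j =
     (toℕ j ℕ.≟ suc (toℕ i))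
  ⊎-dec (toℕ i ℕ.≟ suc (toℕ j))
  ⊎-dec ((toℕ i ℕ.≟ 0) ×-dec (suc (toℕ j) ℕ.≟ n))
  ⊎-dec ((toℕ j ℕ.≟ 0) ×-dec (suc (toℕ i) ℕ.≟ n))

Cycle : (n : ℕ) → Graph n
Cycle n = record { Adj = CycleAdj n ; adj? = cycleAdj? n }

module _ {n k : ℕ} (G : Graph n) (c : Fin n → Fin k) where

  -- c is a k-coloring: a partition of V(G) into k (nonempty) independent sets.
  IsColoring : Set
  IsColoring = (∀ u v → Adj G u v → c u ≢ c v) × (∀ (j : Fin k) → ∃ λ v → c v ≡ j)

  nbrColors : Fin n → Subset k
  nbrColors v = tabulate (λ j → does (any? (λ u → adj? G u v ×-dec (c u ≟ j))))

  colorDegree : Fin n → ℕ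
  colorDegree v = ∣ nbrColors v ∣

  IsNLColoring : Set
  IsNLColoring = IsColoring ×
    (∀ u v → u ≢ v → c u ≡ c v → nbrColors u ≢ nbrColors v)

module Submission where

-- In a graph in which every vertex has exactly two neighbours p and q, the
-- set of colours seen by a vertex w is {c p, c q}; so its colour-degree is 2
-- when c p ≢ c q and 1 otherwise.  Now let v have colour-degree 1, i.e. both
-- neighbours p, q of v share a colour.  A neighbour x of v of colour-degree
-- other than 2 has both its neighbours coloured alike, one of them being v,
-- so x sees exactly {c v}.  If neither p nor q had colour-degree 2, the two
-- distinct equally coloured vertices p and q would see the same colour set,
-- contradicting the neighbour-locating condition.

open import Defs
open import Data.Nat using (ℕ; zero; suc; _≤_; _<_; s≤s; z≤n)
import Data.Nat as ℕ
import Data.Nat.Properties as ℕ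
open import Data.Fin using (Fin; toℕ; fromℕ<; _≟_)
import Data.Fin as Fin
open import Data.Fin.Properties using (any?; toℕ-fromℕ<; toℕ-injective; toℕ<n)
open import Data.Fin.Subset using (Subset; ∣_∣; ⁅_⁆; ⊥)
open import Data.Fin.Subset.Properties using (∣⁅x⁆∣≡1)
open import Data.Vec using (_∷_; tabulate)
open import Data.Vec.Properties using (tabulate-cong)
open import Data.Bool using (false; _∨_)
open import Data.Bool.Properties using (∨-identityʳ)
open import Data.Product using (_×_; ∃; _,_; proj₁; proj₂)
open import Data.Sum using (_⊎_; inj₁; inj₂)
open import Data.Empty using (⊥-elim)
open import Function.Bundles using (mk⇔)
open import Relation.Nullary using (yes; no; does)
open import Relation.Nullary.Decidable using (_×-dec_; _⊎-dec_; does-⇔)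
open import Relation.Binary.PropositionalEquality

pairSet : ∀ {k} → Fin k → Fin k → Subset k
pairSet a b = tabulate (λ j → does ((j ≟ a) ⊎-dec (j ≟ b)))

tabulate-false≡⊥ : ∀ k → tabulate {n = k} (λ _ → false) ≡ ⊥
tabulate-false≡⊥ zero    = refl
tabulate-false≡⊥ (suc k) = cong (false ∷_) (tabulate-false≡⊥ k)

tabulate-≟≡⁅⁆ : ∀ {k} (a : Fin k) → tabulate (λ j → does (j ≟ a)) ≡ ⁅ a ⁆
tabulate-≟≡⁅⁆ {suc k} Fin.zero    = cong (_ ∷_) (tabulate-false≡⊥ k)
tabulate-≟≡⁅⁆         (Fin.suc a) = cong (_ ∷_) (tabulate-≟≡⁅⁆ a)

∣singleton∣≡1 : ∀ {k} (a : Fin k) → ∣ tabulate (λ j → does (j ≟ a)) ∣ ≡ 1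
∣singleton∣≡1 a = trans (cong ∣_∣ (tabulate-≟≡⁅⁆ a)) (∣⁅x⁆∣≡1 a)

∣pairSet∣≡2 : ∀ {k} (a b : Fin k) → a ≢ b → ∣ pairSet a b ∣ ≡ 2
∣pairSet∣≡2 Fin.zero    Fin.zero    a≢b = ⊥-elim (a≢b refl)
∣pairSet∣≡2 Fin.zero    (Fin.suc b) _   = cong suc (∣singleton∣≡1 b)
∣pairSet∣≡2 (Fin.suc a) Fin.zero    _   = cong suc (begin
  ∣ tabulate (λ j → does (j ≟ a) ∨ false) ∣ ≡⟨ cong ∣_∣ (tabulate-cong (λ j → ∨-identityʳ (does (j ≟ a)))) ⟩
  ∣ tabulate (λ j → does (j ≟ a)) ∣         ≡⟨ ∣singleton∣≡1 a ⟩
  1                                         ∎)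
  where open ≡-Reasoning
∣pairSet∣≡2 (Fin.suc a) (Fin.suc b) a≢b = ∣pairSet∣≡2 a b (λ a≡b → a≢b (cong Fin.suc a≡b))

record TwoNeighbours {A : Set} (R : A → A → Set) (w : A) : Set where
  field
    p q   : A
    p≢q   : p ≢ q
    p~w   : R p w
    q~w   : R q w
    only  : ∀ u → R u w → u ≡ p ⊎ u ≡ q

-- The argument for a colouring c of a symmetric graph G whose vertices all have
-- exactly two neighbours; only the neighbour-locating condition on c is needed.
module TwoRegular {n k : ℕ} (G : Graph n)
                  (adj-sym : ∀ u v → Adj G u v → Adj G v u)
                  (two : ∀ w → TwoNeighbours (Adj G) w)
                  (c : Fin n → Fin k) where

  open TwoNeighbours

  nbrColors≡pairSet : ∀ w → nbrColors G c w ≡ pairSet (c (p (two w))) (c (q (two w)))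
  nbrColors≡pairSet w = tabulate-cong λ j →
    does-⇔ (mk⇔ (sees j) (seen j)) (any? λ u → adj? G u w ×-dec (c u ≟ j))
                                   ((j ≟ c (p N)) ⊎-dec (j ≟ c (q N)))
    where
    N = two w
    sees : ∀ j → (∃ λ u → Adj G u w × c u ≡ j) → j ≡ c (p N) ⊎ j ≡ c (q N)
    sees j (u , u~w , cu≡j) with only N u u~w
    ... | inj₁ refl = inj₁ (sym cu≡j)
    ... | inj₂ refl = inj₂ (sym cu≡j)
    seen : ∀ j → j ≡ c (p N) ⊎ j ≡ c (q N) → ∃ λ u → Adj G u w × c u ≡ j
    seen j (inj₁ j≡cp) = p N , p~w N , sym j≡cp
    seen j (inj₂ j≡cq) = q N , q~w N , sym j≡cq

  degreeOne⇒sameColour : ∀ w → colorDegree G c w ≡ 1 → c (p (two w)) ≡ c (q (two w))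
  degreeOne⇒sameColour w deg≡1 with c (p (two w)) ≟ c (q (two w))
  ... | yes cp≡cq = cp≡cq
  ... | no  cp≢cq with trans (sym deg≡1)
                             (trans (cong ∣_∣ (nbrColors≡pairSet w)) (∣pairSet∣≡2 _ _ cp≢cq))
  ...   | ()

  degreeTwo-or-seesOnly : ∀ v x → Adj G x v →
    colorDegree G c x ≡ 2 ⊎ nbrColors G c x ≡ pairSet (c v) (c v)
  degreeTwo-or-seesOnly v x x~v with c (p N) ≟ c (q N) | only N v (adj-sym x v x~v)
    where N = two x
  ... | no  cp≢cq | _ = inj₁ (trans (cong ∣_∣ (nbrColors≡pairSet x)) (∣pairSet∣≡2 _ _ cp≢cq))
  ... | yes cp≡cq | inj₁ refl = inj₂ (trans (nbrColors≡pairSet x) (cong (pairSet (c v)) (sym cp≡cq)))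
  ... | yes cp≡cq | inj₂ refl = inj₂ (trans (nbrColors≡pairSet x) (cong (λ a → pairSet a (c v)) cp≡cq))

  degreeOne⇒neighbourOfDegreeTwo :
    (∀ u v → u ≢ v → c u ≡ c v → nbrColors G c u ≢ nbrColors G c v) →
    ∀ v → colorDegree G c v ≡ 1 → ∃ λ u → Adj G v u × colorDegree G c u ≡ 2
  degreeOne⇒neighbourOfDegreeTwo locating v deg≡1 =
    choose (degreeTwo-or-seesOnly v (p N) (p~w N)) (degreeTwo-or-seesOnly v (q N) (q~w N))
    where
    N = two v
    choose : colorDegree G c (p N) ≡ 2 ⊎ nbrColors G c (p N) ≡ pairSet (c v) (c v) →
             colorDegree G c (q N) ≡ 2 ⊎ nbrColors G c (q N) ≡ pairSet (c v) (c v) →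
             ∃ λ u → Adj G v u × colorDegree G c u ≡ 2
    choose (inj₁ deg≡2) _            = p N , adj-sym _ _ (p~w N) , deg≡2
    choose (inj₂ _)     (inj₁ deg≡2) = q N , adj-sym _ _ (q~w N) , deg≡2
    choose (inj₂ sees₁) (inj₂ sees₂) =
      ⊥-elim (locating (p N) (q N) (p≢q N) (degreeOne⇒sameColour v deg≡1) (trans sees₁ (sym sees₂)))

-- Cycle adjacency read on the underlying natural numbers; CycleAdj n i j is
-- by definition CycleAdjℕ n (toℕ i) (toℕ j).
CycleAdjℕ : ℕ → ℕ → ℕ → Set
CycleAdjℕ n i j =
    (j ≡ suc i) ⊎ (i ≡ suc j) ⊎ ((i ≡ 0) × (suc j ≡ n)) ⊎ ((j ≡ 0) × (suc i ≡ n))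

-- Adjacency of a number below n to j; the bound lets the neighbour be read back in Fin n.
BoundedCycleAdj : ℕ → ℕ → ℕ → Set
BoundedCycleAdj n i j = i < n × CycleAdjℕ n i j

cycleAdj-sym : ∀ n (u v : Fin n) → CycleAdj n u v → CycleAdj n v u
cycleAdj-sym n u v (inj₁ e)               = inj₂ (inj₁ e)
cycleAdj-sym n u v (inj₂ (inj₁ e))        = inj₁ e
cycleAdj-sym n u v (inj₂ (inj₂ (inj₁ e))) = inj₂ (inj₂ (inj₂ e))
cycleAdj-sym n u v (inj₂ (inj₂ (inj₂ e))) = inj₂ (inj₂ (inj₁ e))

first-neighbours : ∀ m → TwoNeighbours (BoundedCycleAdj (3 ℕ.+ m)) 0
first-neighbours m = record
  { p = 1 ; q = suc (suc m) ; p≢q = λ ()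
  ; p~w = s≤s (s≤s z≤n) , inj₂ (inj₁ refl)
  ; q~w = ℕ.≤-refl , inj₂ (inj₂ (inj₂ (refl , refl)))
  ; only = only }
  where
  only : ∀ y → BoundedCycleAdj (3 ℕ.+ m) y 0 → y ≡ 1 ⊎ y ≡ suc (suc m)
  only y (_ , inj₂ (inj₁ y≡1))                 = inj₁ y≡1
  only y (_ , inj₂ (inj₂ (inj₂ (_ , 1+y≡n)))) = inj₂ (ℕ.suc-injective 1+y≡n)
  only y (_ , inj₂ (inj₂ (inj₁ (_ , ()))))

last-neighbours : ∀ m → TwoNeighbours (BoundedCycleAdj (3 ℕ.+ m)) (suc (suc m))
last-neighbours m = record
  { p = suc m ; q = 0 ; p≢q = λ ()
  ; p~w = s≤s (s≤s (ℕ.n≤1+n m)) , inj₁ refl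
  ; q~w = s≤s z≤n , inj₂ (inj₂ (inj₁ (refl , refl)))
  ; only = only }
  where
  only : ∀ y → BoundedCycleAdj (3 ℕ.+ m) y (suc (suc m)) → y ≡ suc m ⊎ y ≡ 0
  only y (_   , inj₁ e)                     = inj₁ (sym (ℕ.suc-injective e))
  only y (y<n , inj₂ (inj₁ refl))           = ⊥-elim (ℕ.n≮n _ y<n)
  only y (_   , inj₂ (inj₂ (inj₁ (y≡0 , _)))) = inj₂ y≡0
  only y (_   , inj₂ (inj₂ (inj₂ (() , _))))

inner-neighbours : ∀ m x → x ≤ m → TwoNeighbours (BoundedCycleAdj (3 ℕ.+ m)) (suc x)
inner-neighbours m x x≤m = record
  { p = x ; q = suc (suc x)
  ; p≢q = λ x≡2+x → ℕ.<⇒≢ (ℕ.m<n+m x (s≤s z≤n)) x≡2+x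
  ; p~w = ℕ.m≤n⇒m≤1+n (s≤s (ℕ.m≤n⇒m≤1+n x≤m)) , inj₁ refl
  ; q~w = s≤s (s≤s (s≤s x≤m)) , inj₂ (inj₁ refl)
  ; only = only }
  where
  only : ∀ y → BoundedCycleAdj (3 ℕ.+ m) y (suc x) → y ≡ x ⊎ y ≡ suc (suc x)
  only y (_ , inj₁ e)                     = inj₁ (sym (ℕ.suc-injective e))
  only y (_ , inj₂ (inj₁ e))              = inj₂ e
  only y (_ , inj₂ (inj₂ (inj₁ (_ , e)))) =
    ⊥-elim (ℕ.<⇒≢ (s≤s (s≤s x≤m)) (ℕ.suc-injective e))
  only y (_ , inj₂ (inj₂ (inj₂ (() , _))))

cycle-neighboursℕ : ∀ m x → x < 3 ℕ.+ m → TwoNeighbours (BoundedCycleAdj (3 ℕ.+ m)) x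
cycle-neighboursℕ m zero    _ = first-neighbours m
cycle-neighboursℕ m (suc x) (s≤s x<2+m) with x ℕ.≟ suc m
... | yes refl = last-neighbours m
... | no  x≢1+m = inner-neighbours m x (ℕ.≤-pred (ℕ.≤∧≢⇒< (ℕ.≤-pred x<2+m) x≢1+m))

toFin-neighbours : ∀ n (w : Fin n) →
  TwoNeighbours (BoundedCycleAdj n) (toℕ w) → TwoNeighbours (CycleAdj n) w
toFin-neighbours n w N = record
  { p = fromℕ< p<n ; q = fromℕ< q<n
  ; p≢q = λ e → p≢q (trans (sym (toℕ-fromℕ< p<n)) (trans (cong toℕ e) (toℕ-fromℕ< q<n)))
  ; p~w = subst (λ i → CycleAdjℕ n i (toℕ w)) (sym (toℕ-fromℕ< p<n)) p~w′
  ; q~w = subst (λ i → CycleAdjℕ n i (toℕ w)) (sym (toℕ-fromℕ< q<n)) q~w′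
  ; only = only′ }
  where
  open TwoNeighbours N
  p<n = proj₁ p~w
  q<n = proj₁ q~w
  p~w′ = proj₂ p~w
  q~w′ = proj₂ q~w
  only′ : ∀ u → CycleAdj n u w → u ≡ fromℕ< p<n ⊎ u ≡ fromℕ< q<n
  only′ u u~w with only (toℕ u) (toℕ<n u , u~w)
  ... | inj₁ u≡p = inj₁ (toℕ-injective (trans u≡p (sym (toℕ-fromℕ< p<n))))
  ... | inj₂ u≡q = inj₂ (toℕ-injective (trans u≡q (sym (toℕ-fromℕ< q<n))))

cycle-neighbours : ∀ n → 3 ≤ n → ∀ w → TwoNeighbours (CycleAdj n) w
cycle-neighbours .(3 ℕ.+ m) (s≤s (s≤s (s≤s {n = m} z≤n))) w =
  toFin-neighbours _ w (cycle-neighboursℕ m (toℕ w) (toℕ<n w))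

lemma8 : (n k : ℕ) → 3 ≤ n → (c : Fin n → Fin k) → IsNLColoring (Cycle n) c →
         ∀ v → colorDegree (Cycle n) c v ≡ 1 →
         ∃ λ u → Adj (Cycle n) v u × colorDegree (Cycle n) c u ≡ 2
lemma8 n k 3≤n c (_ , locating) =
  TwoRegular.degreeOne⇒neighbourOfDegreeTwo
    (Cycle n) (cycleAdj-sym n) (cycle-neighbours n 3≤n) c locating
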